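{- Let $\alpha=\frac{1+\sqrt5}{2}$ and $\beta=\frac{1-\sqrt5}{2}$. For every positive integer $x$ we have $v_2(\alpha^x+1)=v_2(\beta^x+1)\in\{0,1\}$.
   Context: $v_2$ denotes the $2$-adic valuation on $\mathbb{Q}(\sqrt5)$ (in which $2$ is inert), normalized by $v_2(2)=1$. -}

module Defs where

open import Data.Nat using (ℕ; zero; suc)
open import Data.Integer using (ℤ; +_; _+_; _*_; -_)
open import Data.Product using (Σ; _×_)
open import Relation.Binary.PropositionalEquality using (_≡_)
open import Relation.Nullary using (¬_)

-- The ring of integers O = ℤ[α] of ℚ(√5), α = (1+√5)/2, α² = α + 1.
-- An element  a + b·α  is represented by its coordinates (a , b).
record O : Set where
  constructor _+_α
  field
    re : ℤ
    im : ℤ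

infixl 6 _⊕_
infixl 7 _⊗_

_⊕_ : O → O → O
(a + b α) ⊕ (c + d α) = (a + c) + (b + d) α

-- (a + bα)(c + dα) = ac + (ad + bc)α + bd α² = (ac + bd) + (ad + bc + bd)α
_⊗_ : O → O → O
(a + b α) ⊗ (c + d α) = (a * c + b * d) + (a * d + b * c + b * d) α

fromℤ : ℤ → O
fromℤ n = n + (+ 0) α

oneO : O
oneO = fromℤ (+ 1)

twoO : O
twoO = fromℤ (+ 2)

αO : O
αO = (+ 0) + (+ 1) α

-- β = (1-√5)/2 = 1 - α
βO : O
βO = (+ 1) + (- (+ 1)) α

_^O_ : O → ℕ → O
x ^O zero = oneO
x ^O suc n = x ⊗ (x ^O n)

_∣O_ : O → O → Set
d ∣O g = Σ O (λ q → g ≡ d ⊗ q)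

-- 2 is inert in ℚ(√5), so 2O is prime and the 2-adic valuation of a
-- nonzero γ ∈ O is the largest k with 2^k ∣ γ in O.
-- V2 γ k  means  v₂(γ) = k.
V2 : O → ℕ → Set
V2 γ k = ((twoO ^O k) ∣O γ) × ¬ ((twoO ^O suc k) ∣O γ)

{-# OPTIONS --safe #-}
-- α and β both have order dividing 6 in (O/4O)ˣ: α⁶ = 5 + 8α and β⁶ = 13 − 8α.
-- For k ≤ 1 the condition v₂(γ) = k depends only on γ modulo 2^(k+1), hence
-- modulo 4, so v₂(α^x + 1) and v₂(β^x + 1) depend only on x mod 6, and the
-- six residue classes are settled by evaluation.
module Submission where

open import Defs
open import Data.Nat using (ℕ; _≥_)
open import Data.Product using (Σ; _×_)
open import Data.Sum using (_⊎_)
open import Relation.Binary.PropositionalEquality using (_≡_)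

open import Data.Nat as ℕ using (zero; suc; _<_; s≤s; _%_; _/_)
open import Data.Nat.DivMod using (m≡m%n+[m/n]*n; m%n<n)
open import Data.Nat.GeneralisedArithmetic using (fold; fold-+)
open import Data.Integer using (ℤ; +_; _+_; _-_; _*_; -_; _^_; _%ℕ_; _/ℕ_)
open import Data.Integer.DivMod using (a≡a%ℕn+[a/ℕn]*n)
open import Data.Integer.Divisibility.Signed
  using (_∣_; divides; _∣?_; ∣m∣n⇒∣m+n; ∣n⇒∣m*n; ∣m⇒∣-m; ∣m+n∣n⇒∣m; ∣-trans)
open import Data.Integer.Tactic.RingSolver using (solve-∀)
open import Data.Product using (_,_)
open import Data.Sum using (inj₁; inj₂)
open import Function.Bundles using (_⇔_; mk⇔; Equivalence)
import Function.Properties.Equivalence as ⇔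
open import Relation.Binary.PropositionalEquality
  using (refl; sym; trans; cong; cong₂; subst; subst₂; module ≡-Reasoning)
open import Relation.Nullary using (Dec; ¬_; ¬?; _×-dec_)
import Relation.Nullary.Decidable as Dec
open import Relation.Nullary.Decidable using (from-yes; From-yes)

open O

fold-periodic : ∀ {A : Set} {z : A} {s : A → A} p → fold z s p ≡ z → ∀ q → fold z s (q ℕ.* p) ≡ z
fold-periodic p period zero = refl
fold-periodic {z = z} {s} p period (suc q) = begin
  fold z s (p ℕ.+ q ℕ.* p)        ≡⟨ fold-+ z s p ⟩
  fold (fold z s (q ℕ.* p)) s p   ≡⟨ cong (λ w → fold w s p) (fold-periodic p period q) ⟩
  fold z s p                      ≡⟨ period ⟩
  z                               ∎
  where open ≡-Reasoning

fold-% : ∀ {A : Set} {z : A} {s : A → A} p .{{_ : ℕ.NonZero p}} →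
         fold z s p ≡ z → ∀ m → fold z s m ≡ fold z s (m % p)
fold-% {z = z} {s} p period m = begin
  fold z s m                                  ≡⟨ cong (fold z s) (m≡m%n+[m/n]*n m p) ⟩
  fold z s (m % p ℕ.+ (m / p) ℕ.* p)          ≡⟨ fold-+ z s (m % p) ⟩
  fold (fold z s ((m / p) ℕ.* p)) s (m % p)   ≡⟨ cong (λ w → fold w s (m % p)) (fold-periodic p period (m / p)) ⟩
  fold z s (m % p)                            ∎
  where open ≡-Reasoning

fromℤ-∣O⇔ : ∀ {n γ} → fromℤ n ∣O γ ⇔ (n ∣ re γ × n ∣ im γ)
fromℤ-∣O⇔ {n} = mk⇔ to from
  where
  re-fromℤ-⊗ : ∀ n s t → n * s + + 0 * t ≡ s * n
  re-fromℤ-⊗ = solve-∀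
  im-fromℤ-⊗ : ∀ n s t → n * t + + 0 * s + + 0 * t ≡ t * n
  im-fromℤ-⊗ = solve-∀
  to : ∀ {γ} → fromℤ n ∣O γ → n ∣ re γ × n ∣ im γ
  to ((s + t α) , refl) = divides s (re-fromℤ-⊗ n s t) , divides t (im-fromℤ-⊗ n s t)
  from : ∀ {γ} → n ∣ re γ × n ∣ im γ → fromℤ n ∣O γ
  from (divides s a≡sn , divides t b≡tn) =
    (s + t α) , cong₂ _+_α (trans a≡sn (sym (re-fromℤ-⊗ n s t))) (trans b≡tn (sym (im-fromℤ-⊗ n s t)))

_∣O?_ : ∀ n γ → Dec (fromℤ n ∣O γ)
n ∣O? γ = Dec.map (⇔.sym fromℤ-∣O⇔) (n ∣? re γ ×-dec n ∣? im γ)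

infix 4 _≈_[mod_]
record _≈_[mod_] (γ δ : O) (n : ℤ) : Set where
  constructor mk≈
  field
    re-∣ : n ∣ re γ - re δ
    im-∣ : n ∣ im γ - im δ

≈-refl : ∀ {n γ} → γ ≈ γ [mod n ]
≈-refl {n} {a + b α} = mk≈ (divides (+ 0) (self-diff a n)) (divides (+ 0) (self-diff b n))
  where
  self-diff : ∀ a n → a - a ≡ + 0 * n
  self-diff = solve-∀

≈-sym : ∀ {n γ δ} → γ ≈ δ [mod n ] → δ ≈ γ [mod n ]
≈-sym {γ = a + b α} {c + d α} (mk≈ n∣a-c n∣b-d) =
  mk≈ (subst (_ ∣_) (neg-diff a c) (∣m⇒∣-m n∣a-c)) (subst (_ ∣_) (neg-diff b d) (∣m⇒∣-m n∣b-d))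
  where
  neg-diff : ∀ a c → - (a - c) ≡ c - a
  neg-diff = solve-∀

≈-trans : ∀ {n γ δ ε} → γ ≈ δ [mod n ] → δ ≈ ε [mod n ] → γ ≈ ε [mod n ]
≈-trans {γ = a + b α} {c + d α} {e + f α} (mk≈ n∣a-c n∣b-d) (mk≈ n∣c-e n∣d-f) =
  mk≈ (subst (_ ∣_) (telescope a c e) (∣m∣n⇒∣m+n n∣a-c n∣c-e))
      (subst (_ ∣_) (telescope b d f) (∣m∣n⇒∣m+n n∣b-d n∣d-f))
  where
  telescope : ∀ a c e → (a - c) + (c - e) ≡ a - e
  telescope = solve-∀

⊗-congˡ-≈ : ∀ ε {n γ δ} → γ ≈ δ [mod n ] → ε ⊗ γ ≈ ε ⊗ δ [mod n ]
⊗-congˡ-≈ (e + f α) {γ = a + b α} {c + d α} (mk≈ n∣a-c n∣b-d) =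
  mk≈ (subst (_ ∣_) (re-diff e f a b c d) (∣m∣n⇒∣m+n (∣n⇒∣m*n e n∣a-c) (∣n⇒∣m*n f n∣b-d)))
      (subst (_ ∣_) (im-diff e f a b c d)
        (∣m∣n⇒∣m+n (∣m∣n⇒∣m+n (∣n⇒∣m*n e n∣b-d) (∣n⇒∣m*n f n∣a-c)) (∣n⇒∣m*n f n∣b-d)))
  where
  re-diff : ∀ e f a b c d → e * (a - c) + f * (b - d) ≡ (e * a + f * b) - (e * c + f * d)
  re-diff = solve-∀
  im-diff : ∀ e f a b c d →
    e * (b - d) + f * (a - c) + f * (b - d) ≡ (e * b + f * a + f * b) - (e * d + f * c + f * d)
  im-diff = solve-∀

⊕-congʳ-≈ : ∀ ε {n γ δ} → γ ≈ δ [mod n ] → γ ⊕ ε ≈ δ ⊕ ε [mod n ]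
⊕-congʳ-≈ (e + f α) {γ = a + b α} {c + d α} (mk≈ n∣a-c n∣b-d) =
  mk≈ (subst (_ ∣_) (shift-diff a c e) n∣a-c) (subst (_ ∣_) (shift-diff b d f) n∣b-d)
  where
  shift-diff : ∀ a c e → a - c ≡ (a + e) - (c + e)
  shift-diff = solve-∀

∣O-resp-≈ : ∀ {m n γ δ} → m ∣ n → γ ≈ δ [mod n ] → fromℤ m ∣O δ → fromℤ m ∣O γ
∣O-resp-≈ m∣n (mk≈ n∣Δre n∣Δim) m∣δ with Equivalence.to fromℤ-∣O⇔ m∣δ
... | m∣c , m∣d = Equivalence.from fromℤ-∣O⇔
  ( ∣m+n∣n⇒∣m (∣-trans m∣n n∣Δre) (∣m⇒∣-m m∣c)
  , ∣m+n∣n⇒∣m (∣-trans m∣n n∣Δim) (∣m⇒∣-m m∣d))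

fromℤ-⊗ : ∀ a b → fromℤ a ⊗ fromℤ b ≡ fromℤ (a * b)
fromℤ-⊗ a b = cong₂ _+_α (re-eq a b) (im-eq a b)
  where
  re-eq : ∀ a b → a * b + + 0 * + 0 ≡ a * b
  re-eq = solve-∀
  im-eq : ∀ a b → a * + 0 + + 0 * b + + 0 * + 0 ≡ + 0
  im-eq = solve-∀

fromℤ-^O : ∀ a k → fromℤ a ^O k ≡ fromℤ (a ^ k)
fromℤ-^O a zero    = refl
fromℤ-^O a (suc k) = trans (cong (fromℤ a ⊗_) (fromℤ-^O a k)) (fromℤ-⊗ a (a ^ k))

twoO-^O : ∀ k → twoO ^O k ≡ fromℤ ((+ 2) ^ k)
twoO-^O = fromℤ-^O (+ 2)

V2? : ∀ γ k → Dec (V2 γ k)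
V2? γ k = subst₂ (λ d e → Dec (d ∣O γ × ¬ e ∣O γ)) (sym (twoO-^O k)) (sym (twoO-^O (suc k)))
  (((+ 2) ^ k) ∣O? γ ×-dec ¬? (((+ 2) ^ suc k) ∣O? γ))

V2-resp-≈ : ∀ {n γ δ} k → (+ 2) ^ suc k ∣ n → γ ≈ δ [mod n ] → V2 δ k → V2 γ k
V2-resp-≈ {n} k 2ᵏ⁺¹∣n γ≈δ (2ᵏ∣δ , 2ᵏ⁺¹∤δ) =
  twoO^-∣O-resp-≈ k (∣-trans (divides (+ 2) refl) 2ᵏ⁺¹∣n) γ≈δ 2ᵏ∣δ ,
  λ 2ᵏ⁺¹∣γ → 2ᵏ⁺¹∤δ (twoO^-∣O-resp-≈ (suc k) 2ᵏ⁺¹∣n (≈-sym γ≈δ) 2ᵏ⁺¹∣γ)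
  where
  twoO^-∣O-resp-≈ : ∀ {γ δ} j → (+ 2) ^ j ∣ n → γ ≈ δ [mod n ] → (twoO ^O j) ∣O δ → (twoO ^O j) ∣O γ
  twoO^-∣O-resp-≈ {γ} {δ} j 2ʲ∣n γ≈δ =
    subst (λ d → d ∣O δ → d ∣O γ) (sym (twoO-^O j)) (∣O-resp-≈ 2ʲ∣n γ≈δ)

reduce : (n : ℕ) .{{_ : ℕ.NonZero n}} → O → O
reduce n (a + b α) = (+ (a %ℕ n)) + (+ (b %ℕ n)) α

≈-reduce : ∀ n .{{_ : ℕ.NonZero n}} γ → γ ≈ reduce n γ [mod + n ]
≈-reduce n (a + b α) = mk≈ (divides (a /ℕ n) (minus-remainder a)) (divides (b /ℕ n) (minus-remainder b))
  where
  cancel : ∀ r x → (r + x) - r ≡ x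
  cancel = solve-∀
  minus-remainder : ∀ a → a - + (a %ℕ n) ≡ (a /ℕ n) * + n
  minus-remainder a = begin
    a - + (a %ℕ n)                              ≡⟨ cong (_- + (a %ℕ n)) (a≡a%ℕn+[a/ℕn]*n a n) ⟩
    (+ (a %ℕ n) + (a /ℕ n) * + n) - + (a %ℕ n)  ≡⟨ cancel (+ (a %ℕ n)) ((a /ℕ n) * + n) ⟩
    (a /ℕ n) * + n                              ∎
    where open ≡-Reasoning

orbit : (n : ℕ) .{{_ : ℕ.NonZero n}} → O → ℕ → O
orbit n γ = fold oneO (λ ρ → reduce n (γ ⊗ ρ))

^O-≈-orbit : ∀ n .{{_ : ℕ.NonZero n}} γ k → γ ^O k ≈ orbit n γ k [mod + n ]
^O-≈-orbit n γ zero    = ≈-refl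
^O-≈-orbit n γ (suc k) = ≈-trans (⊗-congˡ-≈ γ (^O-≈-orbit n γ k)) (≈-reduce n (γ ⊗ orbit n γ k))

^O-≈-orbit-% : ∀ n .{{_ : ℕ.NonZero n}} γ p .{{_ : ℕ.NonZero p}} →
               orbit n γ p ≡ oneO → ∀ k → γ ^O k ≈ orbit n γ (k % p) [mod + n ]
^O-≈-orbit-% n γ p period k = subst (γ ^O k ≈_[mod + n ]) (fold-% p period k) (^O-≈-orbit n γ k)

decide-V2-orbit⊕1 : ∀ γ r k → From-yes (V2? (orbit 4 γ r ⊕ oneO) k)
decide-V2-orbit⊕1 γ r k = from-yes (V2? (orbit 4 γ r ⊕ oneO) k)

V2-orbit⊕1 : ∀ r → r < 6 →
  Σ ℕ (λ k → (k ≡ 0 ⊎ k ≡ 1) × V2 (orbit 4 αO r ⊕ oneO) k × V2 (orbit 4 βO r ⊕ oneO) k)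
V2-orbit⊕1 0 _ = 1 , inj₂ refl , decide-V2-orbit⊕1 αO 0 1 , decide-V2-orbit⊕1 βO 0 1
V2-orbit⊕1 1 _ = 0 , inj₁ refl , decide-V2-orbit⊕1 αO 1 0 , decide-V2-orbit⊕1 βO 1 0
V2-orbit⊕1 2 _ = 0 , inj₁ refl , decide-V2-orbit⊕1 αO 2 0 , decide-V2-orbit⊕1 βO 2 0
V2-orbit⊕1 3 _ = 1 , inj₂ refl , decide-V2-orbit⊕1 αO 3 1 , decide-V2-orbit⊕1 βO 3 1
V2-orbit⊕1 4 _ = 0 , inj₁ refl , decide-V2-orbit⊕1 αO 4 0 , decide-V2-orbit⊕1 βO 4 0
V2-orbit⊕1 5 _ = 0 , inj₁ refl , decide-V2-orbit⊕1 αO 5 0 , decide-V2-orbit⊕1 βO 5 0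
V2-orbit⊕1 (suc (suc (suc (suc (suc (suc _)))))) (s≤s (s≤s (s≤s (s≤s (s≤s (s≤s ()))))))

2^[1+k]∣4 : ∀ {k} → k ≡ 0 ⊎ k ≡ 1 → (+ 2) ^ suc k ∣ + 4
2^[1+k]∣4 (inj₁ refl) = divides (+ 2) refl
2^[1+k]∣4 (inj₂ refl) = divides (+ 1) refl

corollary1 : (x : ℕ) → x ≥ 1 →
    Σ ℕ (λ k → (k ≡ 0 ⊎ k ≡ 1) × V2 ((αO ^O x) ⊕ oneO) k × V2 ((βO ^O x) ⊕ oneO) k)
corollary1 x _ with V2-orbit⊕1 (x % 6) (m%n<n x 6)
... | k , k≤1 , v₂α , v₂β = k , k≤1 , lift αO refl v₂α , lift βO refl v₂β
  where
  lift : ∀ γ → orbit 4 γ 6 ≡ oneO → V2 (orbit 4 γ (x % 6) ⊕ oneO) k → V2 ((γ ^O x) ⊕ oneO) k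
  lift γ period = V2-resp-≈ k (2^[1+k]∣4 k≤1) (⊕-congʳ-≈ oneO (^O-≈-orbit-% 4 γ 6 period x))
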